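{- Let $p$ be an odd prime, $r\ge3$ an integer with $p\nmid r$, $d\ge2$, and let $G=V\rtimes_\psi D$ with $V=\mathbb{Z}_p^d$, $D=\mathrm{D}_{2r}$ and $\psi$ an irreducible representation of $D$ over $\mathbb{F}_p$. Let $x,y\in D$ be involutions with $D=\langle x,y\rangle$, and let $v,v'$ be non-identity elements of $\mathrm{C}_V(x)$. Then $\mathsf{RotaMap}(G,vx,y)\cong\mathsf{RotaMap}(G,v'x,y)$.
   Context: $\mathrm{D}_{2r}$ is the dihedral group of order $2r$. In $G=V\rtimes_\psi D$, $V=\mathbb{F}_p^d$ is written multiplicatively and $D$ acts by $v^x=\psi(x)^{ -1}(v)$; $\mathrm{C}_V(x)$ is the centralizer of $x$ in $V$. For a group $G$ and $\rho,\tau\in G$ with $|\tau|=2$, $\mathsf{RotaMap}(G,\rho,\tau)$ is the incidence structure with vertex set the cosets of $\langle\rho\rangle$, edge set the cosets of $\langle\tau\rangle$, face set the cosets of $\langle\rho\tau\rangle$, two objects incident iff they intersect nontrivially (a rotary map when $G=\langle\rho,\tau\rangle$). -}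

module Defs where

open import Data.Nat using (ℕ; zero; suc; _+_; _*_; _∸_; NonZero)
open import Data.Nat.DivMod using (_mod_)
open import Data.Fin using (Fin; toℕ; _≟_)
open import Data.Bool using (Bool; true; false; if_then_else_; _xor_)
open import Data.Vec using (Vec; map; zipWith; foldr; replicate; transpose; tabulate)
open import Data.List using (List; []; _∷_)
open import Data.Product using (Σ; _×_; _,_; ∃)
open import Data.Sum using (_⊎_)
open import Data.Empty using (⊥)
open import Relation.Nullary using (¬_; does)
open import Relation.Binary.PropositionalEquality using (_≡_; _≢_)
open import Level using (Level) renaming (suc to lsuc; zero to lzero)

module Fp (p : ℕ) .{{_ : NonZero p}} where
  F : Set
  F = Fin p

  0F 1F : F
  0F = 0 mod p
  1F = 1 mod p

  _+F_ _*F_ : F → F → F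
  a +F b = (toℕ a + toℕ b) mod p
  a *F b = (toℕ a * toℕ b) mod p

  -- V = F_p^d (written additively), d×d matrices (list of rows)
  Vect : ℕ → Set
  Vect d = Vec F d

  Mat : ℕ → Set
  Mat d = Vec (Vec F d) d

  0V : ∀ {d} → Vect d
  0V = replicate _ 0F

  _+V_ : ∀ {d} → Vect d → Vect d → Vect d
  _+V_ = zipWith _+F_

  _·V_ : ∀ {d} → F → Vect d → Vect d
  c ·V v = map (c *F_) v

  dot : ∀ {d} → Vect d → Vect d → F
  dot u v = foldr _ _+F_ 0F (zipWith _*F_ u v)

  apply : ∀ {d} → Mat d → Vect d → Vect d
  apply M v = map (λ row → dot row v) M

  _*M_ : ∀ {d} → Mat d → Mat d → Mat d
  A *M B = map (λ row → map (dot row) (transpose B)) A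

  idM : ∀ {d} → Mat d
  idM = tabulate (λ i → tabulate (λ j → if does (i ≟ j) then 1F else 0F))

-- The dihedral group D_{2r} = { a^i b^s }, with b a b = a^{-1}.
-- (i , false) = a^i ,  (i , true) = a^i b.

module Dihedral (r : ℕ) .{{_ : NonZero r}} where
  D : Set
  D = Fin r × Bool

  negR : Fin r → Fin r
  negR i = (r ∸ toℕ i) mod r

  addR : Fin r → Fin r → Fin r
  addR i j = (toℕ i + toℕ j) mod r

  eD : D
  eD = (0 mod r , false)

  -- (a^i b^s)(a^j b^t) = a^(i + (-1)^s j) b^(s xor t)
  _·D_ : D → D → D
  (i , s) ·D (j , t) = (addR i (if s then negR j else j) , s xor t)

  invD : D → D
  invD (i , false) = (negR i , false)
  invD (i , true)  = (i , true)

  IsInvolution : D → Set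
  IsInvolution x = (x ≢ eD) × (x ·D x ≡ eD)

  word : D → D → List Bool → D
  word x y []        = eD
  word x y (b ∷ bs)  = (if b then x else y) ·D word x y bs

  -- D = ⟨x , y⟩  (D is finite, so the subgroup generated is the
  -- submonoid generated)
  Generates : D → D → Set
  Generates x y = ∀ z → ∃ λ (bs : List Bool) → word x y bs ≡ z

module Setup (p r d : ℕ) .{{_ : NonZero p}} .{{_ : NonZero r}} where
  open Fp p
  open Dihedral r

  V : Set
  V = Vect d

  -- ψ : D → GL_d(F_p) a group homomorphism (invertibility follows)
  IsRep : (D → Mat d) → Set
  IsRep ψ = (ψ eD ≡ idM) × (∀ g h → ψ (g ·D h) ≡ ψ g *M ψ h)

  IsSubspace : (V → Set) → Set
  IsSubspace W = W 0V × (∀ u w → W u → W w → W (u +V w))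
                      × (∀ c w → W w → W (c ·V w))

  IsInvariant : (D → Mat d) → (V → Set) → Set
  IsInvariant ψ W = ∀ g w → W w → W (apply (ψ g) w)

  Irreducible : (D → Mat d) → Set₁
  Irreducible ψ = ∀ (W : V → Set) → IsSubspace W → IsInvariant ψ W →
                  (∀ w → W w → w ≡ 0V) ⊎ (∀ w → W w)

  module _ (ψ : D → Mat d) where
    _^_ : V → D → V
    v ^ x = apply (ψ (invD x)) v

    InCentralizer : D → V → Set
    InCentralizer x v = v ^ x ≡ v

    -- G = V ⋊_ψ D ; element (v , x) stands for v x.
    -- (v x)(w y) = v (x w x^{-1}) x y = v w^{x^{-1}} (x y)
    G : Set
    G = V × D

    _·G_ : G → G → G
    (v , x) ·G (w , y) = (v +V (w ^ invD x) , x ·D y)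

    eG : G
    eG = (0V , eD)

-- Objects are right cosets ⟨a⟩g; a coset ⟨a⟩g is represented by g,
-- and g, h represent the same object iff h ∈ ⟨a⟩g.

module RotaMap {C : Set} (_·_ : C → C → C) (e : C) where
  pow : C → ℕ → C
  pow a zero    = e
  pow a (suc k) = a · pow a k

  -- z ∈ ⟨a⟩g  (G finite, so ⟨a⟩ = { a^k | k ∈ ℕ })
  InCoset : C → C → C → Set
  InCoset a g z = ∃ λ (k : ℕ) → z ≡ pow a k · g

  SameCoset : C → C → C → Set
  SameCoset a g h = InCoset a g h

  Meet : C → C → C → C → Set
  Meet a g b h = ∃ λ z → InCoset a g z × InCoset b h z

  _⇔_ : Set → Set → Set
  A ⇔ B = (A → B) × (B → A)

  CosetBij : C → C → (C → C) → Set
  CosetBij a b f = (∀ g h → SameCoset a g h ⇔ SameCoset b (f g) (f h))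
                 × (∀ h → ∃ λ g → SameCoset b (f g) h)

  -- RotaMap(G,ρ,τ) ≅ RotaMap(G,ρ',τ'): bijections on vertices
  -- (cosets of ⟨ρ⟩), edges (cosets of ⟨τ⟩), faces (cosets of ⟨ρτ⟩)
  -- preserving and reflecting all three incidence relations.
  record RotaMapIso (ρ τ ρ' τ' : C) : Set where
    field
      fV fE fF : C → C
      bijV : CosetBij ρ ρ' fV
      bijE : CosetBij τ τ' fE
      bijF : CosetBij (ρ · τ) (ρ' · τ') fF
      incVE : ∀ g h → Meet ρ g τ h ⇔ Meet ρ' (fV g) τ' (fE h)
      incVF : ∀ g h → Meet ρ g (ρ · τ) h ⇔ Meet ρ' (fV g) (ρ' · τ') (fF h)
      incEF : ∀ g h → Meet τ g (ρ · τ) h ⇔ Meet τ' (fE g) (ρ' · τ') (fF h)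

module Submission where

-- Every automorphism φ of the D-module V gives an automorphism (w , g) ↦ (φ w , g) of V ⋊ D
-- which fixes y and sends v x to (φ v) x, and every group automorphism carries one coset
-- incidence structure isomorphically onto the other. So it suffices to find a module
-- automorphism with φ v = v'. Let T = xy. The vectors Φ v, for Φ linear and commuting with T,
-- form a subspace which is D-invariant, because conjugation by x preserves the commutant of T
-- (x T x = T⁻¹) and y = x T; it contains v ≠ 0, so by irreducibility it is V. Choosing Φ with
-- Φ v = v'/2, the average φ = Φ + xΦx commutes with x and T, hence with D, and φ v = v' because
-- x fixes v and v'. Finally, two module endomorphisms that agree on a nonzero vector agree
-- everywhere (their equalizer is an invariant subspace), which makes φ invertible.

open import Defs
open import Algebra.Bundles using (CommutativeSemigroup)
import Algebra.Properties.CommutativeSemigroup as CommutativeSemigroupProperties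
open import Data.Bool using (true; false)
open import Data.List using ([]; _∷_)
open import Data.Empty using (⊥-elim)
open import Data.Fin using (toℕ)
open import Data.Fin.Properties using (toℕ-injective; toℕ-fromℕ<; toℕ<n)
open import Data.Nat using (ℕ; zero; suc; _+_; _*_; _∸_; _≤_; _%_; _/_; NonZero; s≤s)
open import Data.Nat.Divisibility using (_∣_; m%n≡0⇒n∣m)
open import Data.Nat.DivMod
  using (_mod_; m%n<n; m<n⇒m%n≡m; %-distribˡ-+; %-distribˡ-*; m≡m%n+[m/n]*n; [m+n]%n≡m%n)
open import Data.Nat.Primality using (Prime)
open import Data.Nat.Properties
  using (+-assoc; +-comm; *-assoc; *-comm; *-distribˡ-+; *-identityˡ; +-suc; +-identityʳ; m+[n∸m]≡n; <⇒≤)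
open import Data.Product using (∃; _×_; _,_; proj₁; proj₂)
open import Data.Sum using (inj₁; inj₂)
open import Data.Vec using (Vec; []; _∷_; map; foldr; replicate; transpose; _⊛_)
open import Data.Vec.Properties
  using (zipWith-assoc; zipWith-comm; zipWith-identityˡ; map-cong; map-∘; map-id; map-const; map-replicate;
         tabulate-∘; tabulate-allFin)
open import Relation.Nullary using (¬_)
open import Relation.Binary.PropositionalEquality
  using (_≡_; _≢_; refl; sym; trans; cong; cong₂; subst; isEquivalence; module ≡-Reasoning)

≡-commutativeSemigroup : {A : Set} (_∙_ : A → A → A) →
  (∀ a b c → (a ∙ b) ∙ c ≡ a ∙ (b ∙ c)) → (∀ a b → a ∙ b ≡ b ∙ a) → CommutativeSemigroup _ _
≡-commutativeSemigroup _∙_ assoc comm = record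
  { _∙_ = _∙_
  ; isCommutativeSemigroup = record
    { isSemigroup = record { isMagma = record { isEquivalence = isEquivalence ; ∙-cong = cong₂ _∙_ } ; assoc = assoc }
    ; comm = comm } }

module ModularArithmetic (n : ℕ) .{{_ : NonZero n}} where
  open Fp n
  open ≡-Reasoning

  toℕ-mod : ∀ m → toℕ (m mod n) ≡ m % n
  toℕ-mod m = toℕ-fromℕ< (m%n<n m n)

  toℕ-mod-identity : ∀ a → toℕ a mod n ≡ a
  toℕ-mod-identity a = toℕ-injective (trans (toℕ-mod (toℕ a)) (m<n⇒m%n≡m (toℕ<n a)))

  mod-cong : ∀ {k m} → k % n ≡ m % n → k mod n ≡ m mod n
  mod-cong {k} {m} eq = toℕ-injective (trans (toℕ-mod k) (trans eq (sym (toℕ-mod m))))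

  mod-+ : ∀ k m → (k + m) mod n ≡ (k mod n) +F (m mod n)
  mod-+ k m = mod-cong (trans (%-distribˡ-+ k m n) (sym (cong₂ (λ a b → (a + b) % n) (toℕ-mod k) (toℕ-mod m))))

  mod-* : ∀ k m → (k * m) mod n ≡ (k mod n) *F (m mod n)
  mod-* k m = mod-cong (trans (%-distribˡ-* k m n) (sym (cong₂ (λ a b → (a * b) % n) (toℕ-mod k) (toℕ-mod m))))

  mod-+Fˡ : ∀ k b → (k mod n) +F b ≡ (k + toℕ b) mod n
  mod-+Fˡ k b = trans (cong ((k mod n) +F_) (sym (toℕ-mod-identity b))) (sym (mod-+ k (toℕ b)))

  mod-+Fʳ : ∀ a m → a +F (m mod n) ≡ (toℕ a + m) mod n
  mod-+Fʳ a m = trans (cong (_+F (m mod n)) (sym (toℕ-mod-identity a))) (sym (mod-+ (toℕ a) m))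

  mod-*Fˡ : ∀ k b → (k mod n) *F b ≡ (k * toℕ b) mod n
  mod-*Fˡ k b = trans (cong ((k mod n) *F_) (sym (toℕ-mod-identity b))) (sym (mod-* k (toℕ b)))

  mod-*Fʳ : ∀ a m → a *F (m mod n) ≡ (toℕ a * m) mod n
  mod-*Fʳ a m = trans (cong (_*F (m mod n)) (sym (toℕ-mod-identity a))) (sym (mod-* (toℕ a) m))

  +F-assoc : ∀ a b c → (a +F b) +F c ≡ a +F (b +F c)
  +F-assoc a b c = begin
    (a +F b) +F c                            ≡⟨ mod-+Fˡ (toℕ a + toℕ b) c ⟩
    (toℕ a + toℕ b + toℕ c) mod n            ≡⟨ cong (_mod n) (+-assoc (toℕ a) (toℕ b) (toℕ c)) ⟩
    (toℕ a + (toℕ b + toℕ c)) mod n          ≡⟨ sym (mod-+Fʳ a (toℕ b + toℕ c)) ⟩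
    a +F (b +F c)                            ∎

  +F-comm : ∀ a b → a +F b ≡ b +F a
  +F-comm a b = cong (_mod n) (+-comm (toℕ a) (toℕ b))

  +F-identityˡ : ∀ a → 0F +F a ≡ a
  +F-identityˡ a = trans (mod-+Fˡ 0 a) (toℕ-mod-identity a)

  *F-assoc : ∀ a b c → (a *F b) *F c ≡ a *F (b *F c)
  *F-assoc a b c = begin
    (a *F b) *F c                            ≡⟨ mod-*Fˡ (toℕ a * toℕ b) c ⟩
    (toℕ a * toℕ b * toℕ c) mod n            ≡⟨ cong (_mod n) (*-assoc (toℕ a) (toℕ b) (toℕ c)) ⟩
    (toℕ a * (toℕ b * toℕ c)) mod n          ≡⟨ sym (mod-*Fʳ a (toℕ b * toℕ c)) ⟩
    a *F (b *F c)                            ∎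

  *F-comm : ∀ a b → a *F b ≡ b *F a
  *F-comm a b = cong (_mod n) (*-comm (toℕ a) (toℕ b))

  *F-identityˡ : ∀ a → 1F *F a ≡ a
  *F-identityˡ a = trans (mod-*Fˡ 1 a) (trans (cong (_mod n) (*-identityˡ (toℕ a))) (toℕ-mod-identity a))

  *F-zeroˡ : ∀ a → 0F *F a ≡ 0F
  *F-zeroˡ a = mod-*Fˡ 0 a

  *F-distribˡ-+F : ∀ a b c → a *F (b +F c) ≡ (a *F b) +F (a *F c)
  *F-distribˡ-+F a b c = begin
    a *F (b +F c)                            ≡⟨ mod-*Fʳ a (toℕ b + toℕ c) ⟩
    (toℕ a * (toℕ b + toℕ c)) mod n          ≡⟨ cong (_mod n) (*-distribˡ-+ (toℕ a) (toℕ b) (toℕ c)) ⟩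
    (toℕ a * toℕ b + toℕ a * toℕ c) mod n    ≡⟨ mod-+ (toℕ a * toℕ b) (toℕ a * toℕ c) ⟩
    (a *F b) +F (a *F c)                     ∎

  *F-distribʳ-+F : ∀ a b c → (b +F c) *F a ≡ (b *F a) +F (c *F a)
  *F-distribʳ-+F a b c =
    trans (*F-comm (b +F c) a) (trans (*F-distribˡ-+F a b c) (cong₂ _+F_ (*F-comm a b) (*F-comm a c)))

  open CommutativeSemigroupProperties (≡-commutativeSemigroup _+F_ +F-assoc +F-comm)
    using () renaming (interchange to +F-interchange)
  open CommutativeSemigroupProperties (≡-commutativeSemigroup _*F_ *F-assoc *F-comm)
    using () renaming (x∙yz≈y∙xz to *F-leftComm)

  odd⇒half : ¬ 2 ∣ n → ∃ λ h → h +F h ≡ 1F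
  odd⇒half 2∤n = h , (begin
    h +F h                        ≡⟨ sym (mod-+ (suc k) (suc k)) ⟩
    (suc k + suc k) mod n         ≡⟨ cong (_mod n) twice ⟩
    (1 + n) mod n                 ≡⟨ mod-cong ([m+n]%n≡m%n 1 n) ⟩
    1F                            ∎)
    where
    k : ℕ
    k = n / 2
    h : F
    h = suc k mod n
    n≡1+k*2 : n ≡ 1 + k * 2
    n≡1+k*2 with n % 2 | m≡m%n+[m/n]*n n 2 | m%n≡0⇒n∣m n 2 | m%n<n n 2
    ... | 0             | _  | 2∣n | _ = ⊥-elim (2∤n (2∣n refl))
    ... | 1             | eq | _   | _ = eq
    ... | suc (suc _)   | _  | _   | s≤s (s≤s ())
    twice : suc k + suc k ≡ 1 + n
    twice = begin
      suc k + suc k               ≡⟨ cong suc (+-suc k k) ⟩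
      suc (suc (k + k))           ≡⟨ cong (λ m → suc (suc (k + m))) (sym (+-identityʳ k)) ⟩
      suc (suc (2 * k))           ≡⟨ cong (λ m → suc (suc m)) (*-comm 2 k) ⟩
      suc (1 + k * 2)             ≡⟨ cong suc (sym n≡1+k*2) ⟩
      1 + n                       ∎

  +V-assoc : ∀ {d} (u v w : Vect d) → (u +V v) +V w ≡ u +V (v +V w)
  +V-assoc = zipWith-assoc +F-assoc

  +V-comm : ∀ {d} (u w : Vect d) → u +V w ≡ w +V u
  +V-comm = zipWith-comm +F-comm

  +V-identityˡ : ∀ {d} (u : Vect d) → 0V +V u ≡ u
  +V-identityˡ = zipWith-identityˡ +F-identityˡ

  module _ {d : ℕ} where
    open CommutativeSemigroupProperties (≡-commutativeSemigroup (_+V_ {d}) +V-assoc +V-comm) public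
      using () renaming (interchange to +V-interchange)

  ·V-distribˡ : ∀ {d} c (u w : Vect d) → c ·V (u +V w) ≡ (c ·V u) +V (c ·V w)
  ·V-distribˡ c []      []      = refl
  ·V-distribˡ c (a ∷ u) (b ∷ w) = cong₂ _∷_ (*F-distribˡ-+F c a b) (·V-distribˡ c u w)

  ·V-distribʳ : ∀ {d} c c' (u : Vect d) → (c +F c') ·V u ≡ (c ·V u) +V (c' ·V u)
  ·V-distribʳ c c' []      = refl
  ·V-distribʳ c c' (a ∷ u) = cong₂ _∷_ (*F-distribʳ-+F a c c') (·V-distribʳ c c' u)

  ·V-leftComm : ∀ {d} c c' (u : Vect d) → c ·V (c' ·V u) ≡ c' ·V (c ·V u)
  ·V-leftComm c c' u =
    trans (sym (map-∘ (c *F_) (c' *F_) u)) (trans (map-cong (*F-leftComm c c') u) (map-∘ (c' *F_) (c *F_) u))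

  ·V-identityˡ : ∀ {d} (u : Vect d) → 1F ·V u ≡ u
  ·V-identityˡ u = trans (map-cong *F-identityˡ u) (map-id u)

  ·V-zeroˡ : ∀ {d} (u : Vect d) → 0F ·V u ≡ 0V
  ·V-zeroˡ u = trans (map-cong *F-zeroˡ u) (map-const u 0F)

  dot-comm : ∀ {d} (u w : Vect d) → dot u w ≡ dot w u
  dot-comm u w = cong (foldr _ _+F_ 0F) (zipWith-comm *F-comm u w)

  dot-zeroˡ : ∀ {d} (w : Vect d) → dot 0V w ≡ 0F
  dot-zeroˡ []      = refl
  dot-zeroˡ (b ∷ w) = trans (cong₂ _+F_ (*F-zeroˡ b) (dot-zeroˡ w)) (+F-identityˡ 0F)

  dot-+ʳ : ∀ {d} (z u w : Vect d) → dot z (u +V w) ≡ dot z u +F dot z w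
  dot-+ʳ []      []      []      = sym (+F-identityˡ 0F)
  dot-+ʳ (c ∷ z) (a ∷ u) (b ∷ w) =
    trans (cong₂ _+F_ (*F-distribˡ-+F c a b) (dot-+ʳ z u w)) (+F-interchange (c *F a) (c *F b) (dot z u) (dot z w))

  dot-·ʳ : ∀ {d} c (z u : Vect d) → dot z (c ·V u) ≡ c *F dot z u
  dot-·ʳ c []      []      = sym (trans (*F-comm c 0F) (*F-zeroˡ c))
  dot-·ʳ c (b ∷ z) (a ∷ u) =
    trans (cong₂ _+F_ (*F-leftComm b c a) (dot-·ʳ c z u)) (sym (*F-distribˡ-+F c (b *F a) (dot z u)))

  dot-+ˡ : ∀ {d} (u w z : Vect d) → dot (u +V w) z ≡ dot u z +F dot w z
  dot-+ˡ u w z = trans (dot-comm (u +V w) z) (trans (dot-+ʳ z u w) (cong₂ _+F_ (dot-comm z u) (dot-comm z w)))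

  dot-·ˡ : ∀ {d} c (u z : Vect d) → dot (c ·V u) z ≡ c *F dot u z
  dot-·ˡ c u z = trans (dot-comm (c ·V u) z) (trans (dot-·ʳ c z u) (cong (c *F_) (dot-comm z u)))

  infixr 8 _⊙_
  _⊙_ : ∀ {k m} → Vec (Vect k) m → Vect k → Vect m
  M ⊙ v = map (λ row → dot row v) M

  ⊙-+V : ∀ {k m} (M : Vec (Vect k) m) (u w : Vect k) → M ⊙ (u +V w) ≡ (M ⊙ u) +V (M ⊙ w)
  ⊙-+V []        u w = refl
  ⊙-+V (row ∷ M) u w = cong₂ _∷_ (dot-+ʳ row u w) (⊙-+V M u w)

  ⊙-·V : ∀ {k m} (M : Vec (Vect k) m) c (u : Vect k) → M ⊙ (c ·V u) ≡ c ·V (M ⊙ u)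
  ⊙-·V []        c u = refl
  ⊙-·V (row ∷ M) c u = cong₂ _∷_ (dot-·ʳ c row u) (⊙-·V M c u)

  map-dot-transpose-∷ : ∀ {k m} c (row : Vect m) (b : Vect k) (C : Vec (Vect m) k) →
    map (dot (c ∷ row)) ((replicate k _∷_ ⊛ b) ⊛ C) ≡ (c ·V b) +V map (dot row) C
  map-dot-transpose-∷ c row []      []      = refl
  map-dot-transpose-∷ c row (a ∷ b) (col ∷ C) = cong (_ ∷_) (map-dot-transpose-∷ c row b C)

  dot-transpose : ∀ {k m} (B : Vec (Vect k) m) (row : Vect m) (v : Vect k) →
    dot (map (dot row) (transpose B)) v ≡ dot row (B ⊙ v)
  dot-transpose {k} [] [] v = trans (cong (λ w → dot w v) (map-replicate (dot []) [] k)) (dot-zeroˡ v)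
  dot-transpose (b ∷ B) (c ∷ row) v = begin
    dot (map (dot (c ∷ row)) (transpose (b ∷ B))) v   ≡⟨ cong (λ w → dot w v) (map-dot-transpose-∷ c row b (transpose B)) ⟩
    dot ((c ·V b) +V map (dot row) (transpose B)) v   ≡⟨ dot-+ˡ (c ·V b) _ v ⟩
    dot (c ·V b) v +F dot (map (dot row) (transpose B)) v
                                                      ≡⟨ cong₂ _+F_ (dot-·ˡ c b v) (dot-transpose B row v) ⟩
    (c *F dot b v) +F dot row (B ⊙ v)                 ∎

  apply-*M : ∀ {d} (A B : Mat d) (v : Vect d) → apply (A *M B) v ≡ apply A (apply B v)
  apply-*M A B v = trans (sym (map-∘ _ _ A)) (map-cong (λ row → dot-transpose B row v) A)

  idM-suc : ∀ {d} → idM {suc d} ≡ (1F ∷ 0V) ∷ map (0F ∷_) idM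
  idM-suc = cong₂ _∷_ (cong (1F ∷_) (trans (tabulate-allFin _) (map-const _ 0F))) (tabulate-∘ (0F ∷_) _)

  apply-idM : ∀ {d} (v : Vect d) → apply idM v ≡ v
  apply-idM []      = refl
  apply-idM (a ∷ v) = begin
    apply idM (a ∷ v)                                      ≡⟨ cong (_⊙ (a ∷ v)) idM-suc ⟩
    ((1F *F a) +F dot 0V v) ∷ (map (0F ∷_) idM ⊙ (a ∷ v))  ≡⟨ cong₂ _∷_ head (trans (sym (map-∘ _ _ idM)) (map-cong tail idM)) ⟩
    a ∷ (idM ⊙ v)                                          ≡⟨ cong (a ∷_) (apply-idM v) ⟩
    a ∷ v                                                  ∎
    where
    head : (1F *F a) +F dot 0V v ≡ a
    head = trans (cong₂ _+F_ (*F-identityˡ a) (dot-zeroˡ v)) (trans (+F-comm a 0F) (+F-identityˡ a))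
    tail : ∀ row → (0F *F a) +F dot row v ≡ dot row v
    tail row = trans (cong (_+F dot row v) (*F-zeroˡ a)) (+F-identityˡ (dot row v))

-- Rotation exponents are residues mod r: addR is definitionally Fp._+F_ r.
module DihedralLaws (r : ℕ) .{{_ : NonZero r}} where
  open Dihedral r
  open Fp r using (_+F_)
  open ModularArithmetic r using (mod-+Fʳ; mod-cong; +F-identityˡ)

  addR-negR : ∀ i → addR i (negR i) ≡ 0 mod r
  addR-negR i = begin
    i +F ((r ∸ toℕ i) mod r)      ≡⟨ mod-+Fʳ i (r ∸ toℕ i) ⟩
    (toℕ i + (r ∸ toℕ i)) mod r   ≡⟨ cong (_mod r) (m+[n∸m]≡n (<⇒≤ (toℕ<n i))) ⟩
    r mod r                       ≡⟨ mod-cong ([m+n]%n≡m%n 0 r) ⟩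
    0 mod r                       ∎
    where open ≡-Reasoning

  ·D-identityˡ : ∀ g → eD ·D g ≡ g
  ·D-identityˡ (i , s) = cong (_, s) (+F-identityˡ i)

  ·D-inverseʳ : ∀ g → g ·D invD g ≡ eD
  ·D-inverseʳ (i , false) = cong (_, false) (addR-negR i)
  ·D-inverseʳ (i , true)  = cong (_, false) (addR-negR i)

  invD-eD : invD eD ≡ eD
  invD-eD = trans (sym (·D-identityˡ (invD eD))) (·D-inverseʳ eD)

module AutomorphismRotaMapIso {C : Set} (_·_ : C → C → C) (e : C) (identityˡ : ∀ g → e · g ≡ g)
    (α α⁻¹ : C → C) (α-homo : ∀ g h → α (g · h) ≡ α g · α h) (α-e : α e ≡ e)
    (α-α⁻¹ : ∀ g → α (α⁻¹ g) ≡ g) (α⁻¹-α : ∀ g → α⁻¹ (α g) ≡ g) where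
  open RotaMap _·_ e

  α-injective : ∀ {g h} → α g ≡ α h → g ≡ h
  α-injective {g} {h} αg≡αh = trans (sym (α⁻¹-α g)) (trans (cong α⁻¹ αg≡αh) (α⁻¹-α h))

  α-pow : ∀ a k → α (pow a k) ≡ pow (α a) k
  α-pow a zero    = α-e
  α-pow a (suc k) = trans (α-homo a (pow a k)) (cong (α a ·_) (α-pow a k))

  α-pow· : ∀ a k g → α (pow a k · g) ≡ pow (α a) k · α g
  α-pow· a k g = trans (α-homo (pow a k) g) (cong (_· α g) (α-pow a k))

  α-InCoset : ∀ {a g z} → InCoset a g z → InCoset (α a) (α g) (α z)
  α-InCoset {a} {g} (k , z≡) = k , trans (cong α z≡) (α-pow· a k g)

  α-InCoset⁻¹ : ∀ {a g z} → InCoset (α a) (α g) (α z) → InCoset a g z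
  α-InCoset⁻¹ {a} {g} (k , αz≡) = k , α-injective (trans αz≡ (sym (α-pow· a k g)))

  α-CosetBij : ∀ a a' → α a ≡ a' → CosetBij a a' α
  α-CosetBij a _ refl =
    (λ g h → α-InCoset , α-InCoset⁻¹) , λ h → α⁻¹ h , 0 , trans (sym (α-α⁻¹ h)) (sym (identityˡ _))

  α-Meet : ∀ a a' b b' → α a ≡ a' → α b ≡ b' → ∀ g h → Meet a g b h ⇔ Meet a' (α g) b' (α h)
  α-Meet a _ b _ refl refl g h =
    (λ { (z , z∈ag , z∈bh) → α z , α-InCoset z∈ag , α-InCoset z∈bh }) ,
    (λ { (z , z∈ag , z∈bh) → α⁻¹ z , α-InCoset⁻¹ (subst (InCoset (α a) (α g)) (sym (α-α⁻¹ z)) z∈ag)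
                                   , α-InCoset⁻¹ (subst (InCoset (α b) (α h)) (sym (α-α⁻¹ z)) z∈bh) })

  rotaMapIso : ∀ ρ τ ρ' τ' → α ρ ≡ ρ' → α τ ≡ τ' → RotaMapIso ρ τ ρ' τ'
  rotaMapIso ρ τ ρ' τ' αρ≡ ατ≡ = record
    { fV = α ; fE = α ; fF = α
    ; bijV  = α-CosetBij ρ ρ' αρ≡
    ; bijE  = α-CosetBij τ τ' ατ≡
    ; bijF  = α-CosetBij (ρ · τ) (ρ' · τ') αρτ≡
    ; incVE = α-Meet ρ ρ' τ τ' αρ≡ ατ≡
    ; incVF = α-Meet ρ ρ' (ρ · τ) (ρ' · τ') αρ≡ αρτ≡
    ; incEF = α-Meet τ τ' (ρ · τ) (ρ' · τ') ατ≡ αρτ≡ }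
    where
    αρτ≡ : α (ρ · τ) ≡ ρ' · τ'
    αρτ≡ = trans (α-homo ρ τ) (cong₂ _·_ αρ≡ ατ≡)

module Representation (p r d : ℕ) .{{_ : NonZero p}} .{{_ : NonZero r}}
    (ψ : Dihedral.D r → Fp.Mat p d) (rep : Setup.IsRep p r d ψ) where
  open Fp p
  open Dihedral r
  open Setup p r d
  open ModularArithmetic p
  open DihedralLaws r
  open ≡-Reasoning

  act : D → V → V
  act g = apply (ψ g)

  act-·D : ∀ g h u → act (g ·D h) u ≡ act g (act h u)
  act-·D g h u = trans (cong (λ M → apply M u) (proj₂ rep g h)) (apply-*M (ψ g) (ψ h) u)

  act-eD : ∀ u → act eD u ≡ u
  act-eD u = trans (cong (λ M → apply M u) (proj₁ rep)) (apply-idM u)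

  act-involutive : ∀ {g} → g ·D g ≡ eD → ∀ u → act g (act g u) ≡ u
  act-involutive {g} g²≡e u = trans (sym (act-·D g g u)) (trans (cong (λ k → act k u) g²≡e) (act-eD u))

  InCentralizer⇒fixed : ∀ {g v} → InCentralizer ψ g v → act g v ≡ v
  InCentralizer⇒fixed {g} {v} v∈C = begin
    act g v                    ≡⟨ cong (act g) (sym v∈C) ⟩
    act g (act (invD g) v)     ≡⟨ sym (act-·D g (invD g) v) ⟩
    act (g ·D invD g) v        ≡⟨ cong (λ k → act k v) (·D-inverseʳ g) ⟩
    act eD v                   ≡⟨ act-eD v ⟩
    v                          ∎

  record IsLinear (Φ : V → V) : Set where
    field
      additive    : ∀ u w → Φ (u +V w) ≡ Φ u +V Φ w
      homogeneous : ∀ c u → Φ (c ·V u) ≡ c ·V Φ u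
  open IsLinear public

  Commute : (V → V) → (V → V) → Set
  Commute Φ Θ = ∀ u → Φ (Θ u) ≡ Θ (Φ u)

  IsEndomorphism : (V → V) → Set
  IsEndomorphism Φ = IsLinear Φ × (∀ g → Commute Φ (act g))

  _+ᴸ_ : (V → V) → (V → V) → V → V
  (Φ +ᴸ Ψ) u = Φ u +V Ψ u

  _·ᴸ_ : F → (V → V) → V → V
  (c ·ᴸ Φ) u = c ·V Φ u

  linear-0V : ∀ {Φ} → IsLinear Φ → Φ 0V ≡ 0V
  linear-0V {Φ} Φ-lin = begin
    Φ 0V             ≡⟨ cong Φ (sym (·V-zeroˡ 0V)) ⟩
    Φ (0F ·V 0V)     ≡⟨ homogeneous Φ-lin 0F 0V ⟩
    0F ·V Φ 0V       ≡⟨ ·V-zeroˡ (Φ 0V) ⟩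
    0V               ∎

  linear-id : IsLinear (λ u → u)
  linear-id = record { additive = λ _ _ → refl ; homogeneous = λ _ _ → refl }

  linear-∘ : ∀ {Φ Ψ} → IsLinear Φ → IsLinear Ψ → IsLinear (λ u → Φ (Ψ u))
  linear-∘ {Φ} Φ-lin Ψ-lin = record
    { additive    = λ u w → trans (cong Φ (additive Ψ-lin u w)) (additive Φ-lin _ _)
    ; homogeneous = λ c u → trans (cong Φ (homogeneous Ψ-lin c u)) (homogeneous Φ-lin c _) }

  linear-+ᴸ : ∀ {Φ Ψ} → IsLinear Φ → IsLinear Ψ → IsLinear (Φ +ᴸ Ψ)
  linear-+ᴸ Φ-lin Ψ-lin = record
    { additive    = λ u w → trans (cong₂ _+V_ (additive Φ-lin u w) (additive Ψ-lin u w)) (+V-interchange _ _ _ _)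
    ; homogeneous = λ c u → trans (cong₂ _+V_ (homogeneous Φ-lin c u) (homogeneous Ψ-lin c u)) (sym (·V-distribˡ c _ _)) }

  linear-·ᴸ : ∀ {Φ} c → IsLinear Φ → IsLinear (c ·ᴸ Φ)
  linear-·ᴸ c Φ-lin = record
    { additive    = λ u w → trans (cong (c ·V_) (additive Φ-lin u w)) (·V-distribˡ c _ _)
    ; homogeneous = λ c' u → trans (cong (c ·V_) (homogeneous Φ-lin c' u)) (·V-leftComm c c' _) }

  linear-act : ∀ g → IsLinear (act g)
  linear-act g = record { additive = ⊙-+V (ψ g) ; homogeneous = ⊙-·V (ψ g) }

  commute-∘ : ∀ {Φ Ψ Θ} → Commute Φ Θ → Commute Ψ Θ → Commute (λ u → Φ (Ψ u)) Θ
  commute-∘ {Φ} Φ-Θ Ψ-Θ u = trans (cong Φ (Ψ-Θ u)) (Φ-Θ _)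

  commute-+ᴸ : ∀ {Φ Ψ Θ} → IsLinear Θ → Commute Φ Θ → Commute Ψ Θ → Commute (Φ +ᴸ Ψ) Θ
  commute-+ᴸ Θ-lin Φ-Θ Ψ-Θ u = trans (cong₂ _+V_ (Φ-Θ u) (Ψ-Θ u)) (sym (additive Θ-lin _ _))

  commute-·ᴸ : ∀ {Φ Θ} → IsLinear Θ → ∀ c → Commute Φ Θ → Commute (c ·ᴸ Φ) Θ
  commute-·ᴸ Θ-lin c Φ-Θ u = trans (cong (c ·V_) (Φ-Θ u)) (sym (homogeneous Θ-lin c _))

  commute-act-·D : ∀ {Φ} g h → Commute Φ (act g) → Commute Φ (act h) → Commute Φ (act (g ·D h))
  commute-act-·D {Φ} g h Φ-g Φ-h u = begin
    Φ (act (g ·D h) u)       ≡⟨ cong Φ (act-·D g h u) ⟩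
    Φ (act g (act h u))      ≡⟨ trans (Φ-g (act h u)) (cong (act g) (Φ-h u)) ⟩
    act g (act h (Φ u))      ≡⟨ sym (act-·D g h (Φ u)) ⟩
    act (g ·D h) (Φ u)       ∎

  endomorphism-id : IsEndomorphism (λ u → u)
  endomorphism-id = linear-id , λ _ _ → refl

  endomorphism-∘ : ∀ {Φ Ψ} → IsEndomorphism Φ → IsEndomorphism Ψ → IsEndomorphism (λ u → Φ (Ψ u))
  endomorphism-∘ {Φ} {Ψ} (Φ-lin , Φ-act) (Ψ-lin , Ψ-act) =
    linear-∘ Φ-lin Ψ-lin , λ g → commute-∘ {Φ} {Ψ} {act g} (Φ-act g) (Ψ-act g)

  record ModuleAutomorphism (v v' : V) : Set where
    field
      φ φ⁻¹          : V → V
      φ-endomorphism : IsEndomorphism φ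
      φφ⁻¹           : ∀ u → φ (φ⁻¹ u) ≡ u
      φ⁻¹φ           : ∀ u → φ⁻¹ (φ u) ≡ u
      φv≡v'          : φ v ≡ v'

  extend : (V → V) → G ψ → G ψ
  extend φ (w , g) = φ w , g

  extend-homo : ∀ {φ} → IsEndomorphism φ → ∀ a b → extend φ (_·G_ ψ a b) ≡ _·G_ ψ (extend φ a) (extend φ b)
  extend-homo (φ-lin , φ-act) (w , g) (u , k) =
    cong (_, g ·D k) (trans (additive φ-lin w _) (cong (_ +V_) (φ-act (invD (invD g)) u)))

  G-identityˡ : ∀ a → _·G_ ψ (eG ψ) a ≡ a
  G-identityˡ (w , g) = cong₂ _,_ (begin
    0V +V act (invD (invD eD)) w   ≡⟨ +V-identityˡ _ ⟩
    act (invD (invD eD)) w         ≡⟨ cong (λ k → act (invD k) w) invD-eD ⟩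
    act (invD eD) w                ≡⟨ cong (λ k → act k w) invD-eD ⟩
    act eD w                       ≡⟨ act-eD w ⟩
    w                              ∎) (·D-identityˡ g)

  automorphism-RotaMapIso : ∀ {v v'} → ModuleAutomorphism v v' →
    ∀ g h → RotaMap.RotaMapIso (_·G_ ψ) (eG ψ) (v , g) (0V , h) (v' , g) (0V , h)
  automorphism-RotaMapIso {v} {v'} α g h =
    AutomorphismRotaMapIso.rotaMapIso (_·G_ ψ) (eG ψ) G-identityˡ (extend φ) (extend φ⁻¹)
      (extend-homo φ-endomorphism) (cong (_, eD) φ0V≡0V)
      (λ { (w , k) → cong (_, k) (φφ⁻¹ w) }) (λ { (w , k) → cong (_, k) (φ⁻¹φ w) })
      (v , g) (0V , h) (v' , g) (0V , h) (cong (_, g) φv≡v') (cong (_, h) φ0V≡0V)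
    where
    open ModuleAutomorphism α
    φ0V≡0V : φ 0V ≡ 0V
    φ0V≡0V = linear-0V (proj₁ φ-endomorphism)

  module Irreducibility (irr : Irreducible ψ) where

    invariant-subspace-total : ∀ {W v} → IsSubspace W → IsInvariant ψ W → W v → v ≢ 0V → ∀ w → W w
    invariant-subspace-total {W} {v} W-sub W-inv Wv v≢0 with irr W W-sub W-inv
    ... | inj₁ W≡0 = ⊥-elim (v≢0 (W≡0 v Wv))
    ... | inj₂ W≡V = W≡V

    endomorphisms-agree : ∀ {φ χ v} → IsEndomorphism φ → IsEndomorphism χ → v ≢ 0V → φ v ≡ χ v → ∀ u → φ u ≡ χ u
    endomorphisms-agree {φ} {χ} (φ-lin , φ-act) (χ-lin , χ-act) v≢0 φv≡χv =
      invariant-subspace-total {W = λ u → φ u ≡ χ u} W-sub W-inv φv≡χv v≢0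
      where
      W-sub : IsSubspace (λ u → φ u ≡ χ u)
      W-sub = trans (linear-0V φ-lin) (sym (linear-0V χ-lin))
            , (λ u w φu≡χu φw≡χw →
                 trans (additive φ-lin u w) (trans (cong₂ _+V_ φu≡χu φw≡χw) (sym (additive χ-lin u w))))
            , (λ c w φw≡χw → trans (homogeneous φ-lin c w) (trans (cong (c ·V_) φw≡χw) (sym (homogeneous χ-lin c w))))
      W-inv : IsInvariant ψ (λ u → φ u ≡ χ u)
      W-inv g w φw≡χw = trans (φ-act g w) (trans (cong (act g) φw≡χw) (sym (χ-act g w)))

  module GeneratedByInvolutions (x y : D) (x² : x ·D x ≡ eD) (y² : y ·D y ≡ eD) (gen : Generates x y) where

    generated-induction : (P : D → Set) → P eD → (∀ g → P g → P (x ·D g)) → (∀ g → P g → P (y ·D g)) → ∀ g → P g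
    generated-induction P Pe Px Py g = subst P (proj₂ (gen g)) (onWords (proj₁ (gen g)))
      where
      onWords : ∀ bs → P (word x y bs)
      onWords []           = Pe
      onWords (true ∷ bs)  = Px _ (onWords bs)
      onWords (false ∷ bs) = Py _ (onWords bs)

    invariant-by-generators : ∀ W → (∀ w → W w → W (act x w)) → (∀ w → W w → W (act y w)) → IsInvariant ψ W
    invariant-by-generators W Wx Wy g w Ww =
      generated-induction (λ k → W (act k w)) (subst W (sym (act-eD w)) Ww)
        (λ k W-kw → subst W (sym (act-·D x k w)) (Wx _ W-kw))
        (λ k W-kw → subst W (sym (act-·D y k w)) (Wy _ W-kw)) g

    commute-by-generators : ∀ {Φ} → Commute Φ (act x) → Commute Φ (act y) → ∀ g → Commute Φ (act g)
    commute-by-generators {Φ} Φ-x Φ-y =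
      generated-induction (λ k → Commute Φ (act k)) (λ u → trans (cong Φ (act-eD u)) (sym (act-eD (Φ u))))
        (λ k → commute-act-·D x k Φ-x) (λ k → commute-act-·D y k Φ-y)

    X Y T : V → V
    X = act x
    Y = act y
    T u = X (Y u)

    X-involutive : ∀ u → X (X u) ≡ u
    X-involutive = act-involutive x²

    Y-involutive : ∀ u → Y (Y u) ≡ u
    Y-involutive = act-involutive y²

    IsRotationEndomorphism : (V → V) → Set
    IsRotationEndomorphism Φ = IsLinear Φ × Commute Φ T

    linear-T : IsLinear T
    linear-T = linear-∘ (linear-act x) (linear-act y)

    rotation-id : IsRotationEndomorphism (λ u → u)
    rotation-id = linear-id , λ _ → refl

    rotation-T : IsRotationEndomorphism T
    rotation-T = linear-T , λ _ → refl

    rotation-∘ : ∀ {Φ Ψ} → IsRotationEndomorphism Φ → IsRotationEndomorphism Ψ → IsRotationEndomorphism (λ u → Φ (Ψ u))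
    rotation-∘ {Φ} {Ψ} (Φ-lin , Φ-T) (Ψ-lin , Ψ-T) = linear-∘ Φ-lin Ψ-lin , commute-∘ {Φ} {Ψ} {T} Φ-T Ψ-T

    rotation-+ᴸ : ∀ {Φ Ψ} → IsRotationEndomorphism Φ → IsRotationEndomorphism Ψ → IsRotationEndomorphism (Φ +ᴸ Ψ)
    rotation-+ᴸ {Φ} {Ψ} (Φ-lin , Φ-T) (Ψ-lin , Ψ-T) = linear-+ᴸ Φ-lin Ψ-lin , commute-+ᴸ {Φ} {Ψ} linear-T Φ-T Ψ-T

    rotation-·ᴸ : ∀ {Φ} c → IsRotationEndomorphism Φ → IsRotationEndomorphism (c ·ᴸ Φ)
    rotation-·ᴸ {Φ} c (Φ-lin , Φ-T) = linear-·ᴸ c Φ-lin , commute-·ᴸ {Φ} linear-T c Φ-T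

    commute-T⁻¹ : ∀ {Φ} → Commute Φ T → Commute Φ (λ u → Y (X u))
    commute-T⁻¹ {Φ} Φ-T u = begin
      Φ (Y (X u))                 ≡⟨ sym (trans (cong Y (X-involutive _)) (Y-involutive _)) ⟩
      Y (X (T (Φ (Y (X u)))))     ≡⟨ cong (λ w → Y (X w)) (sym (Φ-T (Y (X u)))) ⟩
      Y (X (Φ (T (Y (X u)))))     ≡⟨ cong (λ w → Y (X (Φ w))) (trans (cong X (Y-involutive _)) (X-involutive u)) ⟩
      Y (X (Φ u))                 ∎

    rotation-conj-X : ∀ {Φ} → IsRotationEndomorphism Φ → IsRotationEndomorphism (λ u → X (Φ (X u)))
    rotation-conj-X {Φ} (Φ-lin , Φ-T) = linear-∘ (linear-act x) (linear-∘ Φ-lin (linear-act x)) , λ u → begin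
      X (Φ (X (T u)))             ≡⟨ cong (λ w → X (Φ w)) (trans (X-involutive (Y u)) (cong Y (sym (X-involutive u)))) ⟩
      X (Φ (Y (X (X u))))         ≡⟨ cong X (commute-T⁻¹ Φ-T (X u)) ⟩
      T (X (Φ (X u)))             ∎

    module _ (irr : Irreducible ψ) where
      open Irreducibility irr

      rotation-orbit-total : ∀ {v} → X v ≡ v → v ≢ 0V → ∀ w → ∃ λ Φ → IsRotationEndomorphism Φ × Φ v ≡ w
      rotation-orbit-total {v} Xv≡v v≢0 =
        invariant-subspace-total {W = W} W-sub W-inv ((λ u → u) , rotation-id , refl) v≢0
        where
        W : V → Set
        W w = ∃ λ Φ → IsRotationEndomorphism Φ × Φ v ≡ w
        W-+V : ∀ u w → W u → W w → W (u +V w)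
        W-+V u w (Φ , Φ-rot , Φv≡u) (Ψ , Ψ-rot , Ψv≡w) = (Φ +ᴸ Ψ) , rotation-+ᴸ Φ-rot Ψ-rot , cong₂ _+V_ Φv≡u Ψv≡w
        W-·V : ∀ c w → W w → W (c ·V w)
        W-·V c w (Φ , Φ-rot , Φv≡w) = (c ·ᴸ Φ) , rotation-·ᴸ c Φ-rot , cong (c ·V_) Φv≡w
        W-sub : IsSubspace W
        W-sub = ((0F ·ᴸ (λ u → u)) , rotation-·ᴸ 0F rotation-id , ·V-zeroˡ v) , W-+V , W-·V
        W-X : ∀ w → W w → W (X w)
        W-X w (Φ , Φ-rot , Φv≡w) =
          (λ u → X (Φ (X u))) , rotation-conj-X Φ-rot , trans (cong (λ u → X (Φ u)) Xv≡v) (cong X Φv≡w)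
        -- Y = X ∘ T, so Y (Φ v) is the value at v of the conjugate of T ∘ Φ by X.
        W-Y : ∀ w → W w → W (Y w)
        W-Y w (Φ , Φ-rot , Φv≡w) = (λ u → X (T (Φ (X u)))) , rotation-conj-X (rotation-∘ rotation-T Φ-rot) , (begin
          X (T (Φ (X v)))    ≡⟨ cong (λ u → X (T (Φ u))) Xv≡v ⟩
          X (T (Φ v))        ≡⟨ cong (λ u → X (T u)) Φv≡w ⟩
          X (X (Y w))        ≡⟨ X-involutive (Y w) ⟩
          Y w                ∎)
        W-inv : IsInvariant ψ W
        W-inv = invariant-by-generators W W-X W-Y

      module _ {h : F} (h+h≡1 : h +F h ≡ 1F) where

        averaged-endomorphism : ∀ {Φ v v'} → IsRotationEndomorphism Φ → X v ≡ v → X v' ≡ v' → Φ v ≡ h ·V v' →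
          ∃ λ φ → IsEndomorphism φ × φ v ≡ v'
        averaged-endomorphism {Φ} {v} {v'} Φ-rot Xv≡v Xv'≡v' Φv≡hv' =
          φ , (proj₁ φ-rot , commute-by-generators φ-X φ-Y) , φv≡v'
          where
          φ : V → V
          φ = Φ +ᴸ (λ u → X (Φ (X u)))
          φ-rot : IsRotationEndomorphism φ
          φ-rot = rotation-+ᴸ Φ-rot (rotation-conj-X Φ-rot)
          φ-X : Commute φ X
          φ-X u = begin
            Φ (X u) +V X (Φ (X (X u)))     ≡⟨ cong (λ w → Φ (X u) +V X (Φ w)) (X-involutive u) ⟩
            Φ (X u) +V X (Φ u)             ≡⟨ +V-comm (Φ (X u)) (X (Φ u)) ⟩
            X (Φ u) +V Φ (X u)             ≡⟨ cong (X (Φ u) +V_) (sym (X-involutive (Φ (X u)))) ⟩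
            X (Φ u) +V X (X (Φ (X u)))     ≡⟨ sym (additive (linear-act x) (Φ u) (X (Φ (X u)))) ⟩
            X (φ u)                        ∎
          φ-Y : Commute φ Y
          φ-Y u = begin
            φ (Y u)                        ≡⟨ cong φ (sym (X-involutive (Y u))) ⟩
            φ (X (T u))                    ≡⟨ φ-X (T u) ⟩
            X (φ (T u))                    ≡⟨ cong X (proj₂ φ-rot u) ⟩
            X (X (Y (φ u)))                ≡⟨ X-involutive (Y (φ u)) ⟩
            Y (φ u)                        ∎
          φv≡v' : φ v ≡ v'
          φv≡v' = begin
            Φ v +V X (Φ (X v))             ≡⟨ cong (λ w → Φ v +V X (Φ w)) Xv≡v ⟩
            Φ v +V X (Φ v)                 ≡⟨ cong (λ w → w +V X w) Φv≡hv' ⟩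
            (h ·V v') +V X (h ·V v')       ≡⟨ cong ((h ·V v') +V_) (trans (homogeneous (linear-act x) h v') (cong (h ·V_) Xv'≡v')) ⟩
            (h ·V v') +V (h ·V v')         ≡⟨ sym (·V-distribʳ h h v') ⟩
            (h +F h) ·V v'                 ≡⟨ cong (_·V v') h+h≡1 ⟩
            1F ·V v'                       ≡⟨ ·V-identityˡ v' ⟩
            v'                             ∎

        centralizer-endomorphism : ∀ {v v'} → X v ≡ v → v ≢ 0V → X v' ≡ v' → ∃ λ φ → IsEndomorphism φ × φ v ≡ v'
        centralizer-endomorphism {v} {v'} Xv≡v v≢0 Xv'≡v' =
          let (Φ , Φ-rot , Φv≡hv') = rotation-orbit-total Xv≡v v≢0 (h ·V v')
          in averaged-endomorphism {Φ} Φ-rot Xv≡v Xv'≡v' Φv≡hv'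

        centralizer-automorphism : ∀ {v v'} → X v ≡ v → v ≢ 0V → X v' ≡ v' → v' ≢ 0V → ModuleAutomorphism v v'
        centralizer-automorphism {v} {v'} Xv≡v v≢0 Xv'≡v' v'≢0 =
          let (φ , φ-endo , φv≡v') = centralizer-endomorphism Xv≡v v≢0 Xv'≡v'
              (φ⁻¹ , φ⁻¹-endo , φ⁻¹v'≡v) = centralizer-endomorphism Xv'≡v' v'≢0 Xv≡v
          in record
            { φ = φ ; φ⁻¹ = φ⁻¹ ; φ-endomorphism = φ-endo ; φv≡v' = φv≡v'
            ; φφ⁻¹ = endomorphisms-agree {φ = λ u → φ (φ⁻¹ u)} {χ = λ u → u}
                       (endomorphism-∘ {φ} {φ⁻¹} φ-endo φ⁻¹-endo) endomorphism-id v'≢0 (trans (cong φ φ⁻¹v'≡v) φv≡v')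
            ; φ⁻¹φ = endomorphisms-agree {φ = λ u → φ⁻¹ (φ u)} {χ = λ u → u}
                       (endomorphism-∘ {φ⁻¹} {φ} φ⁻¹-endo φ-endo) endomorphism-id v≢0 (trans (cong φ⁻¹ φv≡v') φ⁻¹v'≡v) }

proposition3p2 : (p r d : ℕ) {{_ : NonZero p}} {{_ : NonZero r}} →
    Prime p → ¬ (2 ∣ p) → 3 ≤ r → ¬ (p ∣ r) → 2 ≤ d →
    (ψ : Dihedral.D r → Fp.Mat p d) →
    Setup.IsRep p r d ψ → Setup.Irreducible p r d ψ →
    (x y : Dihedral.D r) →
    Dihedral.IsInvolution r x → Dihedral.IsInvolution r y →
    Dihedral.Generates r x y →
    (v v' : Setup.V p r d) →
    Setup.InCentralizer p r d ψ x v → v ≢ Fp.0V p →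
    Setup.InCentralizer p r d ψ x v' → v' ≢ Fp.0V p →
    RotaMap.RotaMapIso (Setup._·G_ p r d ψ) (Setup.eG p r d ψ)
    (v , x) (Fp.0V p , y) (v' , x) (Fp.0V p , y)
proposition3p2 p r d _ 2∤p _ _ _ ψ rep irr x y (_ , x²) (_ , y²) gen v v' v∈C v≢0 v'∈C v'≢0 =
  automorphism-RotaMapIso
    (centralizer-automorphism irr {proj₁ half} (proj₂ half) (InCentralizer⇒fixed v∈C) v≢0 (InCentralizer⇒fixed v'∈C) v'≢0)
    x y
  where
  open Fp p using (_+F_; 1F)
  open Representation p r d ψ rep
  open GeneratedByInvolutions x y x² y² gen
  half : ∃ λ h → h +F h ≡ 1F
  half = ModularArithmetic.odd⇒half p 2∤p
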